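{- Let $M$, $X$, $e$, $f$, $B$, $C$, $A$, $M'$, $C'$, $A'$, $\omega$ be as in the context, and suppose $M'=M[I\,|\,C']$. Then $A'_{ij}\neq\omega+1$ for every $i\in X-e$ and $j\in(E-X)-f$.
   Context: $M$ is a $\mathrm{GF}(4)$-representable matroid on $E$ with a circuit-hyperplane $X$; $e\in X$ and $f\in E-X$ are such that $B=(X-e)\cup f$ is a basis of $M$; and $M=M[I\,|\,C]$ where $C$ is a matrix over $\mathrm{GF}(4)$ with rows indexed by $B$ and columns by $E-B$ of block form $C=\begin{bmatrix}A&\underline1\\ \underline1^T&0\end{bmatrix}$ (rows $X-e$, then $f$; columns $(E-X)-f$, then $e$; $\underline1$ all-ones). $M'$ is the matroid obtained from $M$ by relaxing $X$ (bases $\mathcal{B}(M)\cup\{X\}$), and $C'=\begin{bmatrix}A'&\underline1\\ \underline1^T&\omega\end{bmatrix}$ is a matrix over $\mathrm{GF}(4)$ with the same row and column labels, $A'$ an $(X-e)\times((E-X)-f)$ matrix and $\omega\in\mathrm{GF}(4)-\{0,1\}$. Here $M[I\,|\,C]$ is the vector matroid of $[I\,|\,C]$ with identity columns labelled by the row labels $B$. -}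

module Defs where

open import Data.Nat using (ℕ)
open import Data.Fin using (Fin) renaming (_≟_ to _≟ᶠ_)
open import Data.Bool using (Bool; true; false)
open import Data.List using (List; []; _∷_; _++_; map; foldr; allFin)
open import Data.Product using (Σ; _×_)
open import Relation.Nullary using (¬_; does)
open import Relation.Binary.PropositionalEquality using (_≡_)

-- The field GF(4) = {0, 1, α, β} with β = α + 1 = α².

data GF4 : Set where
  𝟎 𝟏 α β : GF4

infixl 6 _+F_
infixl 7 _*F_

_+F_ : GF4 → GF4 → GF4
𝟎 +F y = y
𝟏 +F 𝟎 = 𝟏
𝟏 +F 𝟏 = 𝟎
𝟏 +F α = β
𝟏 +F β = α
α +F 𝟎 = α
α +F 𝟏 = β
α +F α = 𝟎
α +F β = 𝟏
β +F 𝟎 = β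
β +F 𝟏 = α
β +F α = 𝟏
β +F β = 𝟎

_*F_ : GF4 → GF4 → GF4
𝟎 *F y = 𝟎
𝟏 *F y = y
α *F 𝟎 = 𝟎
α *F 𝟏 = α
α *F α = β
α *F β = 𝟏
β *F 𝟎 = 𝟎
β *F 𝟏 = β
β *F α = 𝟏
β *F β = α

-- Rows (= the basis B):  rx i  for i ∈ X - e  (|X - e| = r),
--                                  rf    for f.
-- Columns (= E - B):               cy j  for j ∈ (E - X) - f  (m of them),
--                                  ce    for e.

data Row (r : ℕ) : Set where
  rx : Fin r → Row r
  rf : Row r

data Col (m : ℕ) : Set where
  cy : Fin m → Col m
  ce : Col m

data El (r m : ℕ) : Set where
  row : Row r → El r m
  col : Col m → El r m

elems : (r m : ℕ) → List (El r m)
elems r m = map (λ i → row (rx i)) (allFin r) ++ row rf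
          ∷ (map (λ j → col (cy j)) (allFin m) ++ col ce ∷ [])

Mat : ℕ → ℕ → Set
Mat r m = Row r → Col m → GF4

blockC : {r m : ℕ} → (Fin r → Fin m → GF4) → Mat r m
blockC A (rx i) (cy j) = A i j
blockC A (rx i) ce     = 𝟏
blockC A rf     (cy j) = 𝟏
blockC A rf     ce     = 𝟎

blockC' : {r m : ℕ} → (Fin r → Fin m → GF4) → GF4 → Mat r m
blockC' A ω (rx i) (cy j) = A i j
blockC' A ω (rx i) ce     = 𝟏
blockC' A ω rf     (cy j) = 𝟏
blockC' A ω rf     ce     = ω

δ : {r : ℕ} → Row r → Row r → GF4
δ (rx i) (rx k) with does (i ≟ᶠ k)
... | true  = 𝟏
... | false = 𝟎
δ (rx i) rf     = 𝟎
δ rf     (rx k) = 𝟎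
δ rf     rf     = 𝟏

vec : {r m : ℕ} → Mat r m → El r m → Row r → GF4
vec C (row i) k = δ k i
vec C (col j) k = C k j

sumL : {A : Set} → (A → GF4) → List A → GF4
sumL f = foldr (λ x acc → f x +F acc) 𝟎

Subset : ℕ → ℕ → Set
Subset r m = El r m → Bool

_⊆_ : {r m : ℕ} → Subset r m → Subset r m → Set
S ⊆ T = ∀ x → S x ≡ true → T x ≡ true

_≐_ : {r m : ℕ} → Subset r m → Subset r m → Set
S ≐ T = ∀ x → S x ≡ T x

Indep : {r m : ℕ} → Mat r m → Subset r m → Set
Indep {r} {m} C S =
  (c : El r m → GF4) →
  (∀ x → S x ≡ false → c x ≡ 𝟎) →
  (∀ k → sumL (λ x → c x *F vec C x k) (elems r m) ≡ 𝟎) →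
  ∀ x → c x ≡ 𝟎

IsBasis : {r m : ℕ} → Mat r m → Subset r m → Set
IsBasis C S = Indep C S × (∀ T → S ⊆ T → Indep C T → T ⊆ S)

IsCircuit : {r m : ℕ} → Mat r m → Subset r m → Set
IsCircuit C S = ¬ Indep C S × (∀ T → T ⊆ S → ¬ (S ⊆ T) → Indep C T)

Spanning : {r m : ℕ} → Mat r m → Subset r m → Set
Spanning {r} {m} C S = Σ (Subset r m) (λ T → IsBasis C T × T ⊆ S)

IsHyperplane : {r m : ℕ} → Mat r m → Subset r m → Set
IsHyperplane C H = ¬ Spanning C H × (∀ T → H ⊆ T → ¬ (T ⊆ H) → Spanning C T)

Xset : {r m : ℕ} → Subset r m
Xset (row (rx i)) = true
Xset (row rf)     = false
Xset (col (cy j)) = false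
Xset (col ce)     = true

-- For i ∈ X − e and j ∈ (E − X) − f, the set (X − xᵢ) ∪ yⱼ is a basis of M whatever
-- A is: its columns in [I | C] are independent and span every other column.  Being a
-- basis of M, it is a basis of M'.  But if A'ᵢⱼ = ω + 1 then
--   ω yⱼ + e + Σₖ (1 + ω A'ₖⱼ) xₖ = 0   in [I | C'],
-- and the coefficient of xᵢ is 1 + ω (ω + 1) = 0 because ω is a root of x² + x + 1;
-- so this is a dependency among the columns of (X − xᵢ) ∪ yⱼ in M'.
module Submission where

open import Defs
open import Data.Nat using (ℕ; zero; suc)
open import Data.Fin using (Fin; zero; suc) renaming (_≟_ to _≟ᶠ_)
open import Data.Fin.Properties using (suc-injective)
open import Data.Bool using (true; false; not; _∨_; if_then_else_)
open import Data.Bool.Properties using (not-¬)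
open import Data.List using (List; []; _∷_; _++_; map; allFin; tabulate)
open import Data.List.Properties using (foldr-map)
open import Data.Product using (_×_; _,_; proj₁; proj₂)
open import Data.Sum using (_⊎_; inj₁)
open import Data.Empty using (⊥-elim)
open import Function using (_∘_)
open import Relation.Nullary using (Dec; yes; no; ¬_; does)
open import Relation.Nullary.Decidable using (True; toWitness; dec-true; dec-false)
open import Relation.Binary.Definitions using (DecidableEquality)
open import Relation.Binary.PropositionalEquality
  using (_≡_; _≢_; refl; sym; trans; cong; cong₂; module ≡-Reasoning)

open ≡-Reasoning

infix 4 _≟_
_≟_ : DecidableEquality GF4
𝟎 ≟ 𝟎 = yes refl
𝟎 ≟ 𝟏 = no λ ()
𝟎 ≟ α = no λ ()
𝟎 ≟ β = no λ ()
𝟏 ≟ 𝟎 = no λ ()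
𝟏 ≟ 𝟏 = yes refl
𝟏 ≟ α = no λ ()
𝟏 ≟ β = no λ ()
α ≟ 𝟎 = no λ ()
α ≟ 𝟏 = no λ ()
α ≟ α = yes refl
α ≟ β = no λ ()
β ≟ 𝟎 = no λ ()
β ≟ 𝟏 = no λ ()
β ≟ α = no λ ()
β ≟ β = yes refl

∀? : {P : GF4 → Set} → (∀ x → Dec (P x)) → Dec (∀ x → P x)
∀? P? with P? 𝟎 | P? 𝟏 | P? α | P? β
... | yes p𝟎 | yes p𝟏 | yes pα | yes pβ = yes λ { 𝟎 → p𝟎 ; 𝟏 → p𝟏 ; α → pα ; β → pβ }
... | no ¬p | _     | _     | _     = no λ p → ¬p (p 𝟎)
... | _     | no ¬p | _     | _     = no λ p → ¬p (p 𝟏)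
... | _     | _     | no ¬p | _     = no λ p → ¬p (p α)
... | _     | _     | _     | no ¬p = no λ p → ¬p (p β)

-- The proposition is read off the expected type, so an identity over GF(4) is proved by
-- decide (∀? λ _ → … ∀? λ _ → _ ≟ _), i.e. by checking every assignment.
decide : {A : Set} (a? : Dec A) → {True a?} → A
decide _ {a} = toWitness a

+F-identityʳ : ∀ x → x +F 𝟎 ≡ x
+F-identityʳ = decide (∀? λ _ → _ ≟ _)

+F-assoc : ∀ x y z → (x +F y) +F z ≡ x +F (y +F z)
+F-assoc = decide (∀? λ _ → ∀? λ _ → ∀? λ _ → _ ≟ _)

+F-comm : ∀ x y → x +F y ≡ y +F x
+F-comm = decide (∀? λ _ → ∀? λ _ → _ ≟ _)

+F-self : ∀ x → x +F x ≡ 𝟎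
+F-self = decide (∀? λ _ → _ ≟ _)

*F-identityʳ : ∀ x → x *F 𝟏 ≡ x
*F-identityʳ = decide (∀? λ _ → _ ≟ _)

*F-zeroʳ : ∀ x → x *F 𝟎 ≡ 𝟎
*F-zeroʳ = decide (∀? λ _ → _ ≟ _)

x*[x+1]≡1 : ∀ x → x ≢ 𝟎 → x ≢ 𝟏 → x *F (x +F 𝟏) ≡ 𝟏
x*[x+1]≡1 𝟎 x≢𝟎 _   = ⊥-elim (x≢𝟎 refl)
x*[x+1]≡1 𝟏 _   x≢𝟏 = ⊥-elim (x≢𝟏 refl)
x*[x+1]≡1 α _   _   = refl
x*[x+1]≡1 β _   _   = refl

∑ : ∀ {n} → (Fin n → GF4) → GF4
∑ {zero}  g = 𝟎
∑ {suc n} g = g zero +F ∑ (g ∘ suc)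

∑-zero : ∀ {n} {g : Fin n → GF4} → (∀ q → g q ≡ 𝟎) → ∑ g ≡ 𝟎
∑-zero {zero}  _    = refl
∑-zero {suc n} g≡𝟎 = cong₂ _+F_ (g≡𝟎 zero) (∑-zero (g≡𝟎 ∘ suc))

∑-single : ∀ {n} {g : Fin n → GF4} p → (∀ q → q ≢ p → g q ≡ 𝟎) → ∑ g ≡ g p
∑-single {suc n} {g} zero off =
  trans (cong (g zero +F_) (∑-zero λ q → off (suc q) λ ())) (+F-identityʳ (g zero))
∑-single {suc n} (suc p) off =
  cong₂ _+F_ (off zero λ ()) (∑-single p λ q q≢p → off (suc q) (q≢p ∘ suc-injective))

∑-pair : ∀ {n} {g : Fin n → GF4} p p′ → p ≢ p′ →
         (∀ q → q ≢ p → q ≢ p′ → g q ≡ 𝟎) → ∑ g ≡ g p +F g p′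
∑-pair zero    zero     p≢p′ _   = ⊥-elim (p≢p′ refl)
∑-pair {g = g} zero (suc p′) _ off =
  cong (g zero +F_) (∑-single p′ λ q q≢p′ → off (suc q) (λ ()) (q≢p′ ∘ suc-injective))
∑-pair {g = g} (suc p) zero _ off =
  trans (cong (g zero +F_) (∑-single p λ q q≢p → off (suc q) (q≢p ∘ suc-injective) λ ()))
        (+F-comm (g zero) (g (suc p)))
∑-pair (suc p) (suc p′) p≢p′ off =
  cong₂ _+F_ (off zero (λ ()) (λ ()))
             (∑-pair p p′ (p≢p′ ∘ cong suc) λ q q≢p q≢p′ →
                off (suc q) (q≢p ∘ suc-injective) (q≢p′ ∘ suc-injective))

∑-indicator : ∀ {n} (p : Fin n) a (h : Fin n → GF4) →
              ∑ (λ q → (if does (q ≟ᶠ p) then a else 𝟎) *F h q) ≡ a *F h p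
∑-indicator p a h = trans (∑-single p off) at-p
  where
  off : ∀ q → q ≢ p → (if does (q ≟ᶠ p) then a else 𝟎) *F h q ≡ 𝟎
  off q q≢p rewrite dec-false (q ≟ᶠ p) q≢p = refl
  at-p : (if does (p ≟ᶠ p) then a else 𝟎) *F h p ≡ a *F h p
  at-p rewrite dec-true (p ≟ᶠ p) refl = refl

∑-indicator₂ : ∀ {n} (p p′ : Fin n) → p ≢ p′ → (h : Fin n → GF4) →
               ∑ (λ q → (if does (q ≟ᶠ p) ∨ does (q ≟ᶠ p′) then 𝟏 else 𝟎) *F h q)
                 ≡ h p +F h p′
∑-indicator₂ p p′ p≢p′ h = trans (∑-pair p p′ p≢p′ off) (cong₂ _+F_ at-p at-p′)
  where
  off : ∀ q → q ≢ p → q ≢ p′ →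
        (if does (q ≟ᶠ p) ∨ does (q ≟ᶠ p′) then 𝟏 else 𝟎) *F h q ≡ 𝟎
  off q q≢p q≢p′ rewrite dec-false (q ≟ᶠ p) q≢p | dec-false (q ≟ᶠ p′) q≢p′ = refl
  at-p : (if does (p ≟ᶠ p) ∨ does (p ≟ᶠ p′) then 𝟏 else 𝟎) *F h p ≡ h p
  at-p rewrite dec-true (p ≟ᶠ p) refl = refl
  at-p′ : (if does (p′ ≟ᶠ p) ∨ does (p′ ≟ᶠ p′) then 𝟏 else 𝟎) *F h p′ ≡ h p′
  at-p′ rewrite dec-false (p′ ≟ᶠ p) (p≢p′ ∘ sym) | dec-true (p′ ≟ᶠ p′) refl = refl

sumL-++ : ∀ {A : Set} (g : A → GF4) xs ys → sumL g (xs ++ ys) ≡ sumL g xs +F sumL g ys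
sumL-++ g []       ys = refl
sumL-++ g (x ∷ xs) ys =
  trans (cong (g x +F_) (sumL-++ g xs ys)) (sym (+F-assoc (g x) (sumL g xs) (sumL g ys)))

sumL-tabulate : ∀ {A : Set} {n} (g : A → GF4) (f : Fin n → A) → sumL g (tabulate f) ≡ ∑ (g ∘ f)
sumL-tabulate {n = zero}  g f = refl
sumL-tabulate {n = suc n} g f = cong (g (f zero) +F_) (sumL-tabulate g (f ∘ suc))

sumL-map-allFin : ∀ {A : Set} {n} (g : A → GF4) (f : Fin n → A) →
                  sumL g (map f (allFin n)) ≡ ∑ (g ∘ f)
sumL-map-allFin {n = n} g f =
  trans (foldr-map (λ x acc → g x +F acc) f 𝟎 (allFin n)) (sumL-tabulate (g ∘ f) (λ q → q))

δ-diag : ∀ {r} (p : Fin r) → δ (rx p) (rx p) ≡ 𝟏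
δ-diag p rewrite dec-true (p ≟ᶠ p) refl = refl

δ-off : ∀ {r} {p q : Fin r} → q ≢ p → δ (rx p) (rx q) ≡ 𝟎
δ-off {p = p} {q} q≢p rewrite dec-false (p ≟ᶠ q) (q≢p ∘ sym) = refl

combination : ∀ {r m} → Mat r m → (El r m → GF4) → Row r → GF4
combination {r} {m} C c k = sumL (λ x → c x *F vec C x k) (elems r m)

identity-block : ∀ {r m} (c : El r m → GF4) k →
                 ∑ (λ q → c (row (rx q)) *F δ k (rx q)) +F c (row rf) *F δ k rf ≡ c (row k)
identity-block c (rx p) = begin
  ∑ (λ q → c (row (rx q)) *F δ (rx p) (rx q)) +F c (row rf) *F 𝟎
    ≡⟨ cong₂ _+F_ (∑-single p λ q q≢p → trans (cong (c (row (rx q)) *F_) (δ-off q≢p)) (*F-zeroʳ _))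
                  (*F-zeroʳ (c (row rf))) ⟩
  c (row (rx p)) *F δ (rx p) (rx p) +F 𝟎
    ≡⟨ +F-identityʳ _ ⟩
  c (row (rx p)) *F δ (rx p) (rx p)
    ≡⟨ cong (c (row (rx p)) *F_) (δ-diag p) ⟩
  c (row (rx p)) *F 𝟏
    ≡⟨ *F-identityʳ _ ⟩
  c (row (rx p)) ∎
identity-block c rf =
  trans (cong (_+F c (row rf) *F 𝟏) (∑-zero λ q → *F-zeroʳ (c (row (rx q)))))
        (*F-identityʳ (c (row rf)))

combination-eval : ∀ {r m} (C : Mat r m) (c : El r m → GF4) k {s} →
  ∑ (λ q → c (col (cy q)) *F C k (cy q)) ≡ s →
  combination C c k ≡ c (row k) +F (s +F c (col ce) *F C k ce)
combination-eval {r} {m} C c k {s} columns = begin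
  combination C c k
    ≡⟨ sumL-++ g (map (row ∘ rx) (allFin r)) (row rf ∷ cols) ⟩
  sumL g (map (row ∘ rx) (allFin r)) +F (g (row rf) +F sumL g cols)
    ≡⟨ cong₂ (λ a b → a +F (g (row rf) +F b)) (sumL-map-allFin g (row ∘ rx)) cols-sum ⟩
  ∑ (g ∘ row ∘ rx) +F (g (row rf) +F (s +F g (col ce)))
    ≡⟨ sym (+F-assoc (∑ (g ∘ row ∘ rx)) (g (row rf)) (s +F g (col ce))) ⟩
  (∑ (g ∘ row ∘ rx) +F g (row rf)) +F (s +F g (col ce))
    ≡⟨ cong (_+F (s +F g (col ce))) (identity-block c k) ⟩
  c (row k) +F (s +F c (col ce) *F C k ce) ∎
  where
  g : El r m → GF4
  g x = c x *F vec C x k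
  cols : List (El r m)
  cols = map (col ∘ cy) (allFin m) ++ col ce ∷ []
  cols-sum : sumL g cols ≡ s +F g (col ce)
  cols-sum = begin
    sumL g cols                                    ≡⟨ sumL-++ g (map (col ∘ cy) (allFin m)) _ ⟩
    sumL g (map (col ∘ cy) (allFin m)) +F sumL g (col ce ∷ [])
      ≡⟨ cong₂ _+F_ (trans (sumL-map-allFin g (col ∘ cy)) columns) (+F-identityʳ (g (col ce))) ⟩
    s +F g (col ce)                                ∎

Supported : ∀ {r m} → Subset r m → (El r m → GF4) → Set
Supported S c = ∀ x → S x ≡ false → c x ≡ 𝟎

relation⇒¬Indep : ∀ {r m} {C : Mat r m} {T : Subset r m} (c : El r m → GF4) x →
  c x ≢ 𝟎 → Supported T c → (∀ k → combination C c k ≡ 𝟎) → ¬ Indep C T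
relation⇒¬Indep c x cx≢𝟎 supported vanishes indep = cx≢𝟎 (indep c supported vanishes x)

-- A relation among the columns of S ∪ {x} in which x occurs: x lies in the span of S.
record Spanned {r m} (C : Mat r m) (S : Subset r m) (x : El r m) : Set where
  field
    coeff     : El r m → GF4
    coeff-x   : coeff x ≢ 𝟎
    supported : ∀ y → S y ≡ false → y ≢ x → coeff y ≡ 𝟎
    vanishes  : ∀ k → combination C coeff k ≡ 𝟎

independent-spanning⇒basis : ∀ {r m} {C : Mat r m} {S : Subset r m} →
  Indep C S → (∀ x → S x ≡ false → Spanned C S x) → IsBasis C S
independent-spanning⇒basis {C = C} {S} indepS spanned = indepS , maximal
  where
  maximal : ∀ T → S ⊆ T → Indep C T → T ⊆ S
  maximal T S⊆T indepT x Tx with S x in Sx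
  ... | true  = refl
  ... | false = ⊥-elim (relation⇒¬Indep coeff x coeff-x supportedT vanishes indepT)
    where
    open Spanned (spanned x Sx)
    supportedT : Supported T coeff
    supportedT y Ty with S y in Sy
    ... | false = supported y Sy λ { refl → not-¬ Tx Ty }
    ... | true  = ⊥-elim (not-¬ (S⊆T y Sy) Ty)

-- The exchanged basis (X − xᵢ) ∪ yⱼ, with xᵢ = rx i and yⱼ = cy j

exchange : ∀ {r m} → Fin r → Fin m → Subset r m
exchange i j (row (rx k)) = not (does (k ≟ᶠ i))
exchange i j (row rf)     = false
exchange i j (col (cy q)) = does (q ≟ᶠ j)
exchange i j (col ce)     = true

module _ {r m : ℕ} (A : Fin r → Fin m → GF4) (i : Fin r) (j : Fin m) where

  private
    C : Mat r m
    C = blockC A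

    S : Subset r m
    S = exchange i j

  exchange-indep : Indep C S
  exchange-indep c supported vanishes = all-zero
    where
    row-equation : ∀ k →
      c (row k) +F (c (col (cy j)) *F C k (cy j) +F c (col ce) *F C k ce) ≡ 𝟎
    row-equation k = trans (sym (combination-eval C c k columns)) (vanishes k)
      where
      columns : ∑ (λ q → c (col (cy q)) *F C k (cy q)) ≡ c (col (cy j)) *F C k (cy j)
      columns = ∑-single j λ q q≢j →
        cong (_*F C k (cy q)) (supported (col (cy q)) (dec-false (q ≟ᶠ j) q≢j))

    c-f : c (row rf) ≡ 𝟎
    c-f = supported (row rf) refl

    c-xᵢ : c (row (rx i)) ≡ 𝟎
    c-xᵢ = supported (row (rx i)) (cong not (dec-true (i ≟ᶠ i) refl))

    c-yⱼ : c (col (cy j)) ≡ 𝟎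
    c-yⱼ = begin
      c (col (cy j))
        ≡⟨ sym (trans (cong₂ _+F_ (*F-identityʳ _) (*F-zeroʳ _)) (+F-identityʳ _)) ⟩
      c (col (cy j)) *F 𝟏 +F c (col ce) *F 𝟎
        ≡⟨ cong (_+F (c (col (cy j)) *F 𝟏 +F c (col ce) *F 𝟎)) (sym c-f) ⟩
      c (row rf) +F (c (col (cy j)) *F 𝟏 +F c (col ce) *F 𝟎)
        ≡⟨ row-equation rf ⟩
      𝟎 ∎

    c-e : c (col ce) ≡ 𝟎
    c-e = begin
      c (col ce)                   ≡⟨ sym (*F-identityʳ _) ⟩
      c (col ce) *F 𝟏
        ≡⟨ cong₂ (λ u v → u +F (v *F A i j +F c (col ce) *F 𝟏)) (sym c-xᵢ) (sym c-yⱼ) ⟩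
      c (row (rx i)) +F (c (col (cy j)) *F A i j +F c (col ce) *F 𝟏)
        ≡⟨ row-equation (rx i) ⟩
      𝟎                            ∎

    c-x : ∀ k → c (row (rx k)) ≡ 𝟎
    c-x k = begin
      c (row (rx k))               ≡⟨ sym (+F-identityʳ _) ⟩
      c (row (rx k)) +F 𝟎
        ≡⟨ cong₂ (λ v w → c (row (rx k)) +F (v *F A k j +F w *F 𝟏)) (sym c-yⱼ) (sym c-e) ⟩
      c (row (rx k)) +F (c (col (cy j)) *F A k j +F c (col ce) *F 𝟏)
        ≡⟨ row-equation (rx k) ⟩
      𝟎                            ∎

    all-zero : ∀ x → c x ≡ 𝟎
    all-zero (row (rx k)) = c-x k
    all-zero (row rf)     = c-f
    all-zero (col (cy q)) with q ≟ᶠ j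
    ... | yes refl = c-yⱼ
    ... | no q≢j   = supported (col (cy q)) (dec-false (q ≟ᶠ j) q≢j)
    all-zero (col ce)     = c-e

  xᵢ-spanned : Spanned C S (row (rx i))
  -- e = Σₖ xₖ, the circuit X.
  xᵢ-spanned = record { coeff = c ; coeff-x = λ () ; supported = supported ; vanishes = vanishes }
    where
    c : El r m → GF4
    c (row (rx _)) = 𝟏
    c (row rf)     = 𝟎
    c (col (cy _)) = 𝟎
    c (col ce)     = 𝟏
    supported : ∀ y → S y ≡ false → y ≢ row (rx i) → c y ≡ 𝟎
    supported (row (rx k)) Sy y≢xᵢ with k ≟ᶠ i
    supported (row (rx k)) Sy y≢xᵢ | yes refl = ⊥-elim (y≢xᵢ refl)
    supported (row (rx k)) () _    | no _
    supported (row rf)     _  _ = refl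
    supported (col (cy _)) _  _ = refl
    supported (col ce)     () _
    vanishes : ∀ k → combination C c k ≡ 𝟎
    vanishes k = trans (combination-eval C c k columns) (row-sum k)
      where
      columns : ∑ (λ q → c (col (cy q)) *F C k (cy q)) ≡ 𝟎
      columns = ∑-zero {m} λ _ → refl
      row-sum : ∀ k → c (row k) +F (𝟎 +F 𝟏 *F C k ce) ≡ 𝟎
      row-sum (rx _) = refl
      row-sum rf     = refl

  private
    rows-cancel : ∀ a b → (a +F b) +F (a +F b *F 𝟏) ≡ 𝟎
    rows-cancel = decide (∀? λ _ → ∀? λ _ → _ ≟ _)

  f-spanned : Spanned C S (row rf)
  -- f = yⱼ + Aᵢⱼ e + Σₖ (Aₖⱼ + Aᵢⱼ) xₖ, from column j of [I | C] and e = Σₖ xₖ.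
  f-spanned = record { coeff = c ; coeff-x = λ () ; supported = supported ; vanishes = vanishes }
    where
    c : El r m → GF4
    c (row (rx k)) = A k j +F A i j
    c (row rf)     = 𝟏
    c (col (cy q)) = if does (q ≟ᶠ j) then 𝟏 else 𝟎
    c (col ce)     = A i j
    supported : ∀ y → S y ≡ false → y ≢ row rf → c y ≡ 𝟎
    supported (row (rx k)) Sy _ with k ≟ᶠ i
    supported (row (rx k)) Sy _ | yes refl = +F-self (A i j)
    supported (row (rx k)) () _ | no _
    supported (row rf)     _  y≢f = ⊥-elim (y≢f refl)
    supported (col (cy q)) Sy _ rewrite Sy = refl
    supported (col ce)     () _
    vanishes : ∀ k → combination C c k ≡ 𝟎
    vanishes k = trans (combination-eval C c k (∑-indicator j 𝟏 (C k ∘ cy))) (row-sum k)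
      where
      row-sum : ∀ k → c (row k) +F (𝟏 *F C k (cy j) +F A i j *F C k ce) ≡ 𝟎
      row-sum (rx k) = rows-cancel (A k j) (A i j)
      row-sum rf     = cong (λ t → 𝟏 +F (𝟏 +F t)) (*F-zeroʳ (A i j))

  y-spanned : ∀ q′ → q′ ≢ j → Spanned C S (col (cy q′))
  -- The sum of the two relations for f obtained from columns j and q′.
  y-spanned q′ q′≢j =
    record { coeff = c ; coeff-x = coeff-x ; supported = supported ; vanishes = vanishes }
    where
    c : El r m → GF4
    c (row (rx k)) = (A k j +F A k q′) +F (A i j +F A i q′)
    c (row rf)     = 𝟎
    c (col (cy q)) = if does (q ≟ᶠ j) ∨ does (q ≟ᶠ q′) then 𝟏 else 𝟎
    c (col ce)     = A i j +F A i q′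
    coeff-x : c (col (cy q′)) ≢ 𝟎
    coeff-x rewrite dec-false (q′ ≟ᶠ j) q′≢j | dec-true (q′ ≟ᶠ q′) refl = λ ()
    supported : ∀ y → S y ≡ false → y ≢ col (cy q′) → c y ≡ 𝟎
    supported (row (rx k)) Sy _ with k ≟ᶠ i
    supported (row (rx k)) Sy _ | yes refl = +F-self (A i j +F A i q′)
    supported (row (rx k)) () _ | no _
    supported (row rf)     _  _ = refl
    supported (col (cy q)) Sy y≢y′
      rewrite Sy | dec-false (q ≟ᶠ q′) (λ q≡q′ → y≢y′ (cong (col ∘ cy) q≡q′)) = refl
    supported (col ce)     () _
    vanishes : ∀ k → combination C c k ≡ 𝟎
    vanishes k =
      trans (combination-eval C c k (∑-indicator₂ j q′ (q′≢j ∘ sym) (C k ∘ cy))) (row-sum k)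
      where
      row-sum : ∀ k → c (row k) +F ((C k (cy j) +F C k (cy q′)) +F c (col ce) *F C k ce) ≡ 𝟎
      row-sum (rx k) = rows-cancel (A k j +F A k q′) (A i j +F A i q′)
      row-sum rf     = *F-zeroʳ (A i j +F A i q′)

  exchange-basis : IsBasis C S
  exchange-basis = independent-spanning⇒basis exchange-indep spanned
    where
    spanned : ∀ x → S x ≡ false → Spanned C S x
    spanned (row (rx k)) Sx with k ≟ᶠ i
    spanned (row (rx k)) Sx | yes refl = xᵢ-spanned
    spanned (row (rx k)) () | no _
    spanned (row rf)     _  = f-spanned
    spanned (col (cy q)) Sx with q ≟ᶠ j
    spanned (col (cy q)) () | yes _
    spanned (col (cy q)) Sx | no q≢j = y-spanned q q≢j
    spanned (col ce)     ()

exchange-dependent : ∀ {r m} (A' : Fin r → Fin m → GF4) (i : Fin r) (j : Fin m) {ω} →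
  ω ≢ 𝟎 → ω ≢ 𝟏 → A' i j ≡ ω +F 𝟏 → ¬ Indep (blockC' A' ω) (exchange i j)
exchange-dependent {r} {m} A' i j {ω} ω≢𝟎 ω≢𝟏 A'ᵢⱼ≡ω+1 =
  relation⇒¬Indep c (col ce) (λ ()) supported vanishes
  where
  c : El r m → GF4
  c (row (rx k)) = 𝟏 +F ω *F A' k j
  c (row rf)     = 𝟎
  c (col (cy q)) = if does (q ≟ᶠ j) then ω else 𝟎
  c (col ce)     = 𝟏
  supported : Supported (exchange i j) c
  supported (row (rx k)) Sx with k ≟ᶠ i
  supported (row (rx k)) Sx | yes refl =
    cong (𝟏 +F_) (trans (cong (ω *F_) A'ᵢⱼ≡ω+1) (x*[x+1]≡1 ω ω≢𝟎 ω≢𝟏))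
  supported (row (rx k)) () | no _
  supported (row rf)     _  = refl
  supported (col (cy q)) Sx rewrite Sx = refl
  supported (col ce)     ()
  vanishes : ∀ k → combination (blockC' A' ω) c k ≡ 𝟎
  vanishes k =
    trans (combination-eval (blockC' A' ω) c k (∑-indicator j ω (blockC' A' ω k ∘ cy))) (row-sum k)
    where
    row-sum : ∀ k → c (row k) +F (ω *F blockC' A' ω k (cy j) +F 𝟏 *F blockC' A' ω k ce) ≡ 𝟎
    row-sum (rx k) = x-row (ω *F A' k j)
      where
      x-row : ∀ x → (𝟏 +F x) +F (x +F 𝟏 *F 𝟏) ≡ 𝟎
      x-row = decide (∀? λ _ → _ ≟ _)
    row-sum rf     = f-row ω
      where
      f-row : ∀ w → 𝟎 +F (w *F 𝟏 +F 𝟏 *F w) ≡ 𝟎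
      f-row = decide (∀? λ _ → _ ≟ _)

lemma6p2 : (r m : ℕ) (A A' : Fin r → Fin m → GF4) (ω : GF4) →
    ω ≢ 𝟎 → ω ≢ 𝟏 →
    IsCircuit (blockC A) Xset → IsHyperplane (blockC A) Xset →
    (∀ S → (IsBasis (blockC' A' ω) S → IsBasis (blockC A) S ⊎ S ≐ Xset)
         × (IsBasis (blockC A) S ⊎ S ≐ Xset → IsBasis (blockC' A' ω) S)) →
    ∀ i j → A' i j ≢ ω +F 𝟏
lemma6p2 r m A A' ω ω≢𝟎 ω≢𝟏 _ _ bases i j A'ᵢⱼ≡ω+1 =
  exchange-dependent A' i j ω≢𝟎 ω≢𝟏 A'ᵢⱼ≡ω+1
    (proj₁ (proj₂ (bases (exchange i j)) (inj₁ (exchange-basis A i j))))
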